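{- Let $(D,\tau,d,\Delta)$ be an instance of Train Makespan Optimization with $m=|A|$, and let $k\in[m]$ with $k\le d$. A convoy routing in $D$ using exactly $k$ disjoint paths can be transformed into a solution of Min-Max Disjoint Paths with $k$ paths in $D'_k$ with the same objective value, and vice versa.
   Context: Train Makespan Optimization instance: directed graph $D=(V,A)$, travel times $\tau_a\in\mathbb{Z}_{\ge0}$, source $s$, sink $t$, number $d$ of trains, headway $\Delta\in\mathbb{Z}_{\ge1}$. A convoy routing consists of $k\le d$ pairwise arc-disjoint $s$-$t$-paths $P_1,\dots,P_k$ and $\sigma\in\mathbb{Z}_{\ge1}^k$ with $\sum_i\sigma_i=d$; its objective value (makespan) is $\max_i\{\tau(P_i)+(\sigma_i-1)\Delta\}$, where $\tau(P)=\sum_{a\in P}\tau_a$. The gadget $G_k$ is a sequence of $d-k$ bundles in series, starting at a new vertex $s'$; each bundle consists of one arc of travel time $\Delta$ and $k-1$ parallel arcs of travel time $0$. $D'_k$ is obtained from $D$ by identifying the end vertex of $G_k$ with $s$, so $D'_k$ has source $s'$ and sink $t$. Min-Max Disjoint Paths with $k$ paths in $D'_k$: find $k$ pairwise arc-disjoint $s'$-$t$-paths minimizing the maximum path length. -}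

module Defs where

open import Data.Nat using (ℕ; zero; suc; _+_; _*_; _∸_; _⊔_; _≤_)
open import Data.Fin using (Fin; zero; suc; fromℕ; inject₁)
open import Data.List using (List; []; _∷_; map; foldr; tabulate)
open import Data.Nat.ListAction using (sum)
open import Data.Product using (_×_; _,_)
open import Data.Sum using (_⊎_; inj₁; inj₂)
open import Relation.Binary.PropositionalEquality using (_≡_)
open import Relation.Nullary using (¬_)
open import Data.List.Relation.Unary.Unique.Propositional using (Unique)
open import Data.List.Relation.Binary.Disjoint.Propositional using (Disjoint)

record Digraph : Set₁ where
  field
    V    : Set
    A    : Set
    tail : A → V
    head : A → V
open Digraph public

data Walk (G : Digraph) : V G → V G → List (A G) → Set where
  nil  : ∀ {u} → Walk G u u []
  cons : ∀ {u v a p} → tail G a ≡ u → Walk G (head G a) v p → Walk G u v (a ∷ p)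

IsPath : (G : Digraph) → V G → V G → List (A G) → Set
IsPath G u v p = Walk G u v p × Unique (u ∷ map (head G) p)

len : {X : Set} → (X → ℕ) → List X → ℕ
len τ p = sum (map τ p)

maxFin : (k : ℕ) → (Fin k → ℕ) → ℕ
maxFin k f = foldr _⊔_ 0 (tabulate f)

sumFin : (k : ℕ) → (Fin k → ℕ) → ℕ
sumFin k f = sum (tabulate f)

DisjointPaths : (G : Digraph) → V G → V G → (k : ℕ) → (Fin k → List (A G)) → Set
DisjointPaths G u v k P =
  (∀ i → IsPath G u v (P i)) × (∀ i j → ¬ (i ≡ j) → Disjoint (P i) (P j))

graph : (n m : ℕ) → (Fin m → Fin n) → (Fin m → Fin n) → Digraph
graph n m tl hd = record { V = Fin n ; A = Fin m ; tail = tl ; head = hd }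

record ConvoyRouting (G : Digraph) (s t : V G) (d k : ℕ) : Set where
  field
    paths    : Fin k → List (A G)
    disjoint : DisjointPaths G s t k paths
    σ        : Fin k → ℕ
    σ-pos    : ∀ i → 1 ≤ σ i
    σ-sum    : sumFin k σ ≡ d

makespan : {G : Digraph} {s t : V G} {d k : ℕ} →
           (A G → ℕ) → (Δ : ℕ) → ConvoyRouting G s t d k → ℕ
makespan {k = k} τ Δ R =
  maxFin k (λ i → len τ (ConvoyRouting.paths R i) + (ConvoyRouting.σ R i ∸ 1) * Δ)

-- With r = d ∸ k bundles, the new gadget vertices are  inj₂ j  (j : Fin r);
-- vertex inj₂ j lies  toℕ j + 1  bundles before s. Hence s' = inj₂ (fromℕ (r-1))
-- (and s' = s when r = 0), the successor of inj₂ zero is s, and the successor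
-- of inj₂ (suc j) is inj₂ (inject₁ j).  Bundle j consists of the arcs
-- inj₂ (j , b), b : Fin k, from inj₂ j to its successor; b = zero is the
-- arc of travel time Δ, the k-1 others have travel time 0.

gadgetNext : {W : Set} → W → (r : ℕ) → Fin r → W ⊎ Fin r
gadgetNext s (suc r) zero    = inj₁ s
gadgetNext s (suc r) (suc j) = inj₂ (inject₁ j)

D' : (G : Digraph) → V G → (r k : ℕ) → Digraph
D' G s r k = record
  { V    = V G ⊎ Fin r
  ; A    = A G ⊎ (Fin r × Fin k)
  ; tail = λ { (inj₁ a) → inj₁ (tail G a) ; (inj₂ (j , b)) → inj₂ j }
  ; head = λ { (inj₁ a) → inj₁ (head G a) ; (inj₂ (j , b)) → gadgetNext s r j }
  }

sPrime : {W : Set} → W → (r : ℕ) → W ⊎ Fin r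
sPrime s zero    = inj₁ s
sPrime s (suc r) = inj₂ (fromℕ r)

bundleτ : (Δ : ℕ) {k : ℕ} → Fin k → ℕ
bundleτ Δ zero    = Δ
bundleτ Δ (suc _) = 0

τ' : {X : Set} → (X → ℕ) → (Δ : ℕ) {r k : ℕ} → X ⊎ (Fin r × Fin k) → ℕ
τ' τ Δ (inj₁ a)       = τ a
τ' τ Δ (inj₂ (j , b)) = bundleτ Δ b

minMaxObj : {X : Set} → (X → ℕ) → (k : ℕ) → (Fin k → List X) → ℕ
minMaxObj τ k Q = maxFin k (λ i → len τ (Q i))

{-# OPTIONS --safe #-}
-- Every s′–t path of D′_k crosses the d − k bundles one after the other and then
-- continues as an s–t path of D, so it is determined by that path and by the arc
-- it takes in each bundle. For k arc-disjoint such paths the k arcs of a bundle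
-- are used injectively, hence bijectively: in every bundle exactly one path pays
-- Δ. A path paying Δ in σᵢ − 1 bundles is therefore a convoy path carrying σᵢ
-- trains, and the σᵢ add up to k + (d − k) = d. Conversely, given σ, cut the
-- bundles into consecutive blocks of sizes σᵢ − 1, let path i take the Δ-arc in
-- its own block, and spread the other arcs over the other paths by a transposition.
module Submission where

open import Defs
open import Data.Nat using (ℕ; _≤_; _∸_)
open import Data.Fin using (Fin)
open import Data.List using (List)
open import Data.Product using (Σ; _×_)
open import Data.Sum using (_⊎_)
open import Relation.Binary.PropositionalEquality using (_≡_)

open import Data.Bool using (if_then_else_)
open import Data.Fin using (zero; suc; fromℕ; inject₁; opposite; punchOut; _≟_; _↑ˡ_; _↑ʳ_)
open import Data.Fin.Permutation.Components using (transpose; transpose-inverse)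
open import Data.Fin.Properties
  using (any?; inject₁-injective; fromℕ≢inject₁; opposite-involutive; punchOut-injective; <⇒notInjective)
open import Data.List using ([]; _∷_; map; tabulate; _++_; foldr)
open import Data.List.Properties using (map-++; map-∘; map-cong; map-tabulate; tabulate-cong)
open import Data.List.Membership.Propositional using (_∈_; _∉_)
open import Data.List.Membership.Propositional.Properties
  using (∈-map⁺; ∈-map⁻; ∈-++⁺ˡ; ∈-++⁺ʳ; ∈-++⁻; ∈-tabulate⁺; ∈-tabulate⁻)
open import Data.List.Relation.Binary.Disjoint.Propositional using (Disjoint)
open import Data.List.Relation.Unary.All.Properties using (¬Any⇒All¬)
open import Data.List.Relation.Unary.AllPairs using (_∷_)
open import Data.List.Relation.Unary.Unique.Propositional using (Unique)
open import Data.List.Relation.Unary.Unique.Propositional.Properties using (map⁺; map⁻)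
open import Data.Nat using (zero; suc; _+_; _*_; _⊔_; z≤n; s≤s)
open import Data.Nat.ListAction using (sum)
open import Data.Nat.ListAction.Properties using (sum-++)
open import Data.Nat.Properties
  using (+-assoc; +-comm; +-identityʳ; +-cancelˡ-≡; m+[n∸m]≡n; n<1+n; +-0-commutativeMonoid; +-*-semiring)
open import Data.Product using (∃; Σ-syntax; _,_; proj₁; proj₂; map₁)
open import Data.Sum using (inj₁; inj₂; map₂)
open import Data.Sum.Properties using (inj₁-injective; inj₂-injective)
import Data.Vec.Functional as Vector
open Vector using (Vector)
import Data.Vec.Functional.Properties as Vectorₚ
open import Function using (_∘_)
open import Function.Definitions using (Injective)
open import Relation.Binary.PropositionalEquality
  using (_≢_; refl; sym; trans; cong; cong₂; subst; subst₂; module ≡-Reasoning)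
open import Relation.Nullary using (does; yes; no; contradiction)
open import Relation.Nullary.Decidable using (dec-true; dec-false)

open import Algebra.Properties.CommutativeMonoid.Sum +-0-commutativeMonoid
  using (sum-syntax; ∑-comm; ∑-distrib-+; sum-cong-≗; sum-replicate-zero) renaming (sum to ∑)
open import Algebra.Properties.Semiring.Sum +-*-semiring using (*-distribʳ-sum)

δ : ∀ {n} → Fin n → Fin n → ℕ
δ x y = if does (x ≟ y) then 1 else 0

δ-refl : ∀ {n} (x : Fin n) → δ x x ≡ 1
δ-refl x = cong (if_then 1 else 0) (dec-true (x ≟ x) refl)

δ-≢ : ∀ {n} {x y : Fin n} → x ≢ y → δ x y ≡ 0
δ-≢ {x = x} {y} x≢y = cong (if_then 1 else 0) (dec-false (x ≟ y) x≢y)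

δ-injective : ∀ {m n} {f : Fin m → Fin n} → Injective _≡_ _≡_ f → ∀ x y → δ (f x) (f y) ≡ δ x y
δ-injective {f = f} inj x y with x ≟ y
... | yes refl = δ-refl (f x)
... | no x≢y   = δ-≢ (x≢y ∘ inj)

sumFin≡∑ : ∀ n (f : Fin n → ℕ) → sumFin n f ≡ ∑[ i < n ] f i
sumFin≡∑ zero    f = refl
sumFin≡∑ (suc n) f = cong (f zero +_) (sumFin≡∑ n (f ∘ suc))

∑-1 : ∀ n → ∑[ i < n ] 1 ≡ n
∑-1 zero    = refl
∑-1 (suc n) = cong suc (∑-1 n)

∑-suc : ∀ n (f : Fin n → ℕ) → ∑[ i < n ] suc (f i) ≡ n + ∑[ i < n ] f i
∑-suc n f = trans (∑-distrib-+ (λ _ → 1) f) (cong (_+ ∑ f) (∑-1 n))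

∑-↑ : ∀ m n (f : Fin (m + n) → ℕ) →
      ∑[ i < m + n ] f i ≡ ∑[ i < m ] f (i ↑ˡ n) + ∑[ j < n ] f (m ↑ʳ j)
∑-↑ zero    n f = refl
∑-↑ (suc m) n f = trans (cong (f zero +_) (∑-↑ m n (f ∘ suc))) (sym (+-assoc (f zero) _ _))

∑-δ : ∀ {n} (x : Fin n) → ∑[ i < n ] δ i x ≡ 1
∑-δ {suc n} zero    = cong suc (sum-replicate-zero n)
∑-δ {suc n} (suc x) = ∑-δ x

injective⇒surjective : ∀ {n} {f : Fin n → Fin n} → Injective _≡_ _≡_ f → ∀ y → ∃ λ x → f x ≡ y
injective⇒surjective {suc n} {f} inj y with any? (λ x → f x ≟ y)
... | yes hit = hit
... | no miss = contradiction (λ {x} {x′} → punchOut∘f-injective {x} {x′}) (<⇒notInjective (n<1+n n))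
  where
  y≢f : ∀ x → y ≢ f x
  y≢f x y≡fx = miss (x , sym y≡fx)

  punchOut∘f-injective : Injective _≡_ _≡_ (λ x → punchOut (y≢f x))
  punchOut∘f-injective e = inj (punchOut-injective (y≢f _) (y≢f _) e)

∑-δ-injective : ∀ {n} {f : Fin n → Fin n} → Injective _≡_ _≡_ f → ∀ y → ∑[ i < n ] δ (f i) y ≡ 1
∑-δ-injective inj y with injective⇒surjective inj y
... | x , refl = trans (sum-cong-≗ (λ i → δ-injective inj i x)) (∑-δ x)

blockOwner : ∀ {k} (a : Vector ℕ k) → Vector (Fin k) (∑ a)
blockOwner {zero}  a = λ ()
blockOwner {suc k} a = Vector.replicate (a zero) zero Vector.++ (suc ∘ blockOwner (Vector.tail a))

blockOwner-fibre : ∀ {k} (a : Vector ℕ k) i → ∑[ p < ∑ a ] δ i (blockOwner a p) ≡ a i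
blockOwner-fibre {suc k} a i = begin
  ∑[ p < a zero + R ] δ i (blockOwner a p)
    ≡⟨ ∑-↑ (a zero) R _ ⟩
  ∑[ p < a zero ] δ i (blockOwner a (p ↑ˡ R)) + ∑[ p < R ] δ i (blockOwner a (a zero ↑ʳ p))
    ≡⟨ cong₂ _+_ (sum-cong-≗ (cong (δ i) ∘ Vectorₚ.lookup-++ˡ zeros rest))
                 (sum-cong-≗ (cong (δ i) ∘ Vectorₚ.lookup-++ʳ zeros rest)) ⟩
  ∑[ p < a zero ] δ i zero + ∑[ p < R ] δ i (rest p)
    ≡⟨ blocks i ⟩
  a i ∎
  where
  open ≡-Reasoning

  R : ℕ
  R = ∑ (Vector.tail a)

  zeros : Vector (Fin (suc k)) (a zero)
  zeros = Vector.replicate (a zero) zero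

  rest : Vector (Fin (suc k)) R
  rest = suc ∘ blockOwner (Vector.tail a)

  blocks : ∀ i → ∑[ p < a zero ] δ i zero + ∑[ p < R ] δ i (rest p) ≡ a i
  blocks zero    = trans (cong₂ _+_ (∑-1 (a zero)) (sum-replicate-zero R)) (+-identityʳ (a zero))
  blocks (suc i) = trans (cong (_+ ∑ (δ i ∘ blockOwner (Vector.tail a))) (sum-replicate-zero (a zero)))
                         (blockOwner-fibre (Vector.tail a) i)

opposite-injective : ∀ {n} → Injective _≡_ _≡_ (opposite {n})
opposite-injective {x = i} {j} e =
  trans (sym (opposite-involutive i)) (trans (cong opposite e) (opposite-involutive j))

transpose-matchˡ : ∀ {n} (i j : Fin n) → transpose i j i ≡ j
transpose-matchˡ i j rewrite dec-true (i ≟ i) refl = refl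

transpose-injective : ∀ {n} {i j : Fin n} → Injective _≡_ _≡_ (transpose i j)
transpose-injective {i = i} {j} e =
  trans (sym (transpose-inverse j i)) (trans (cong (transpose j i) e) (transpose-inverse j i))

maxFin-cong : ∀ n {f g : Fin n → ℕ} → (∀ i → f i ≡ g i) → maxFin n f ≡ maxFin n g
maxFin-cong n f≗g = cong (foldr _⊔_ 0) (tabulate-cong f≗g)

record GraphHom (G H : Digraph) : Set where
  field
    vertex       : V G → V H
    arc          : A G → A H
    tail-commute : ∀ a → tail H (arc a) ≡ vertex (tail G a)
    head-commute : ∀ a → head H (arc a) ≡ vertex (head G a)

module _ {G H : Digraph} (f : GraphHom G H) where
  open GraphHom f

  OutArcsLift : Set
  OutArcsLift = ∀ x a → tail H a ≡ vertex x → ∃ λ a′ → arc a′ ≡ a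

  walk-map : ∀ {u v p} → Walk G u v p → Walk H (vertex u) (vertex v) (map arc p)
  walk-map nil                   = nil
  walk-map (cons {a = a} refl w) =
    cons (tail-commute a) (subst (λ x → Walk H x _ _) (sym (head-commute a)) (walk-map w))

  vertices-map : ∀ u p → vertex u ∷ map (head H) (map arc p) ≡ map vertex (u ∷ map (head G) p)
  vertices-map u p = cong (vertex u ∷_) (begin
    map (head H) (map arc p)     ≡⟨ map-∘ p ⟨
    map (head H ∘ arc) p         ≡⟨ map-cong head-commute p ⟩
    map (vertex ∘ head G) p      ≡⟨ map-∘ p ⟩
    map vertex (map (head G) p)  ∎)
    where open ≡-Reasoning

  path-map : Injective _≡_ _≡_ vertex → ∀ {u v p} → IsPath G u v p → IsPath H (vertex u) (vertex v) (map arc p)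
  path-map inj (w , p!) = walk-map w , subst Unique (sym (vertices-map _ _)) (map⁺ inj p!)

  ∉-vertices-map : ∀ {y} → (∀ x → y ≢ vertex x) → ∀ u p → y ∉ vertex u ∷ map (head H) (map arc p)
  ∉-vertices-map {y} y∉img u p y∈ with ∈-map⁻ vertex (subst (y ∈_) (vertices-map u p) y∈)
  ... | x , _ , y≡fx = y∉img x y≡fx

  module _ (inj : Injective _≡_ _≡_ vertex) (lifts : OutArcsLift) where

    walk-lift : ∀ {x y q u v} → Walk H x y q → x ≡ vertex u → y ≡ vertex v →
                ∃ λ p → q ≡ map arc p × Walk G u v p
    walk-lift nil refl fu≡fv with inj fu≡fv
    ... | refl = [] , refl , nil
    walk-lift (cons {a = a} ta≡x w) x≡fu y≡fv with lifts _ a (trans ta≡x x≡fu)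
    ... | a′ , refl with walk-lift w (head-commute a′) y≡fv
    ...   | p , refl , w′ = a′ ∷ p , refl , cons (inj (trans (sym (tail-commute a′)) (trans ta≡x x≡fu))) w′

    path-lift : ∀ {u v q} → IsPath H (vertex u) (vertex v) q → ∃ λ p → q ≡ map arc p × IsPath G u v p
    path-lift (w , q!) with walk-lift w refl refl
    ... | p , refl , w′ = p , refl , w′ , map⁻ (subst Unique (vertices-map _ p) q!)

path-∷ : ∀ {G : Digraph} {u x v a q} → tail G a ≡ u → head G a ≡ x → u ∉ x ∷ map (head G) q →
         IsPath G x v q → IsPath G u v (a ∷ q)
path-∷ refl refl u∉ (w , q!) = cons refl w , ¬Any⇒All¬ _ u∉ ∷ q!

liftBundle : ∀ {X : Set} {r k} → X ⊎ (Fin r × Fin k) → X ⊎ (Fin (suc r) × Fin k)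
liftBundle = map₂ (map₁ inject₁)

gadgetNext-inject₁ : ∀ {W : Set} (s : W) r (j : Fin r) →
                     gadgetNext s (suc r) (inject₁ j) ≡ map₂ inject₁ (gadgetNext s r j)
gadgetNext-inject₁ s (suc r) zero    = refl
gadgetNext-inject₁ s (suc r) (suc j) = refl

gadgetNext-fromℕ : ∀ {W : Set} (s : W) r → gadgetNext s (suc r) (fromℕ r) ≡ map₂ inject₁ (sPrime s r)
gadgetNext-fromℕ s zero    = refl
gadgetNext-fromℕ s (suc r) = refl

-- D' G s r k sits inside D' G s (suc r) k as everything after the first bundle.
module Gadget (G : Digraph) (s : V G) (k : ℕ) where

  embed : ∀ r → GraphHom G (D' G s r k)
  embed r = record { vertex = inj₁ ; arc = inj₁ ; tail-commute = λ _ → refl ; head-commute = λ _ → refl }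

  embed-lifts : ∀ r → OutArcsLift (embed r)
  embed-lifts r x (inj₁ a) _ = a , refl

  shift : ∀ r → GraphHom (D' G s r k) (D' G s (suc r) k)
  shift r = record
    { vertex       = map₂ inject₁
    ; arc          = liftBundle
    ; tail-commute = λ { (inj₁ a) → refl ; (inj₂ (j , b)) → refl }
    ; head-commute = λ { (inj₁ a) → refl ; (inj₂ (j , b)) → gadgetNext-inject₁ s r j }
    }

  shift-injective : ∀ r → Injective _≡_ _≡_ (GraphHom.vertex (shift r))
  shift-injective r {inj₁ _} {inj₁ _} refl = refl
  shift-injective r {inj₂ _} {inj₂ _} e    = cong inj₂ (inject₁-injective (inj₂-injective e))

  shift-lifts : ∀ r → OutArcsLift (shift r)
  shift-lifts r x        (inj₁ a)       _    = inj₁ a , refl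
  shift-lifts r (inj₂ j) (inj₂ (_ , b)) refl = inj₂ (j , b) , refl

  fromℕ∉shift : ∀ r x → inj₂ (fromℕ r) ≢ GraphHom.vertex (shift r) x
  fromℕ∉shift r (inj₂ j) e = fromℕ≢inject₁ (inj₂-injective e)

-- The p-th bundle crossed from s′ (counting from 0) is bundle opposite p, since bundle j lies
-- j + 1 bundles before s.
route : ∀ {X : Set} {r k} → (Fin r → Fin k) → List X → List (X ⊎ (Fin r × Fin k))
route c P = tabulate (λ p → inj₂ (opposite p , c p)) ++ map inj₁ P

route-suc : ∀ {X : Set} {r k} (c : Fin (suc r) → Fin k) (P : List X) →
            route c P ≡ inj₂ (fromℕ r , c zero) ∷ map liftBundle (route (c ∘ suc) P)
route-suc {X} {r} {k} c P = cong (_ ∷_) (sym (begin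
  map liftBundle (tabulate gadget ++ map inj₁ P)
    ≡⟨ map-++ liftBundle (tabulate gadget) (map inj₁ P) ⟩
  map liftBundle (tabulate gadget) ++ map liftBundle (map inj₁ P)
    ≡⟨ cong₂ _++_ (map-tabulate gadget liftBundle) (sym (map-∘ P)) ⟩
  tabulate (liftBundle ∘ gadget) ++ map inj₁ P ∎))
  where
  open ≡-Reasoning

  gadget : Fin r → X ⊎ (Fin r × Fin k)
  gadget p = inj₂ (opposite p , c (suc p))

∈-route⁻ : ∀ {X : Set} {r k} {c : Fin r → Fin k} {P : List X} {x} → x ∈ route c P →
           (∃ λ p → x ≡ inj₂ (opposite p , c p)) ⊎ (∃ λ a → a ∈ P × x ≡ inj₁ a)
∈-route⁻ x∈ = Data.Sum.map ∈-tabulate⁻ (∈-map⁻ inj₁) (∈-++⁻ _ x∈)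

module _ {X : Set} {r k : ℕ} {c c′ : Fin r → Fin k} {P P′ : List X} where

  route-disjoint : Disjoint P P′ → (∀ p → c p ≢ c′ p) → Disjoint (route c P) (route c′ P′)
  route-disjoint P#P′ c≢c′ (x∈ , x∈′) with ∈-route⁻ x∈ | ∈-route⁻ x∈′
  ... | inj₁ (p , refl) | inj₁ (p′ , e) with opposite-injective (cong proj₁ (inj₂-injective e))
  ...   | refl = c≢c′ p (cong proj₂ (inj₂-injective e))
  route-disjoint P#P′ c≢c′ _ | inj₂ (a , a∈ , refl) | inj₂ (_ , a∈′ , refl) = P#P′ (a∈ , a∈′)

  route-disjoint⁻ : Disjoint (route c P) (route c′ P′) → Disjoint P P′ × (∀ p → c p ≢ c′ p)
  route-disjoint⁻ Q#Q′ = arcs , bundles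
    where
    arcs : Disjoint P P′
    arcs (a∈ , a∈′) = Q#Q′ (∈-++⁺ʳ _ (∈-map⁺ inj₁ a∈) , ∈-++⁺ʳ _ (∈-map⁺ inj₁ a∈′))

    bundles : ∀ p → c p ≢ c′ p
    bundles p e = Q#Q′ ( ∈-++⁺ˡ (∈-tabulate⁺ p)
                       , subst (λ b → inj₂ (opposite p , b) ∈ route c′ P′) (sym e) (∈-++⁺ˡ (∈-tabulate⁺ p)))

module _ {G : Digraph} {s t : V G} {k : ℕ} where
  open Gadget G s k

  D′ : ℕ → Digraph
  D′ r = D' G s r k

  route-isPath : ∀ {r} (c : Fin r → Fin k) {P} → IsPath G s t P → IsPath (D′ r) (sPrime s r) (inj₁ t) (route c P)
  route-isPath {zero}  c π = path-map (embed zero) inj₁-injective π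
  route-isPath {suc r} c {P} π =
    subst (IsPath (D′ (suc r)) _ _) (sym (route-suc c P)) (path-∷ refl (gadgetNext-fromℕ s r) fresh shifted)
    where
    rest : List (A G ⊎ (Fin r × Fin k))
    rest = route (c ∘ suc) P

    shifted : IsPath (D′ (suc r)) (map₂ inject₁ (sPrime s r)) (inj₁ t) (map liftBundle rest)
    shifted = path-map (shift r) (shift-injective r) (route-isPath (c ∘ suc) π)

    fresh : inj₂ (fromℕ r) ∉ map₂ inject₁ (sPrime s r) ∷ map (head (D′ (suc r))) (map liftBundle rest)
    fresh = ∉-vertices-map (shift r) (fromℕ∉shift r) (sPrime s r) rest

  path⇒route : ∀ {r q} → IsPath (D′ r) (sPrime s r) (inj₁ t) q →
               Σ[ c ∈ (Fin r → Fin k) ] Σ[ P ∈ List (A G) ] q ≡ route c P × IsPath G s t P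
  path⇒route {zero} π with path-lift (embed zero) inj₁-injective (embed-lifts zero) π
  ... | P , refl , π′ = (λ ()) , P , refl , π′
  path⇒route {suc r} (cons {a = inj₂ (_ , b)} refl w , _ ∷ q!)
    with path-lift (shift r) (shift-injective r) (shift-lifts r)
                   (subst (λ x → IsPath (D′ (suc r)) x (inj₁ t) _) (gadgetNext-fromℕ s r) (w , q!))
  ... | _ , refl , π with path⇒route π
  ...   | c , P , refl , πP = b Vector.∷ c , P , sym (route-suc (b Vector.∷ c) P) , πP

countΔ : ∀ {r k} → (Fin r → Fin (suc k)) → ℕ
countΔ {r} c = ∑[ p < r ] δ (c p) zero

bundleτ≡δ*Δ : ∀ Δ {k} (b : Fin (suc k)) → bundleτ Δ b ≡ δ b zero * Δ
bundleτ≡δ*Δ Δ zero    = sym (+-identityʳ Δ)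
bundleτ≡δ*Δ Δ (suc b) = refl

len-route : ∀ {X : Set} (τ : X → ℕ) Δ {r k} (c : Fin r → Fin (suc k)) P →
            len (τ' τ Δ) (route c P) ≡ len τ P + countΔ c * Δ
len-route {X} τ Δ {r} {k} c P = begin
  len (τ' τ Δ) (tabulate gadget ++ map inj₁ P)
    ≡⟨ cong sum (map-++ (τ' τ Δ) (tabulate gadget) (map inj₁ P)) ⟩
  sum (map (τ' τ Δ) (tabulate gadget) ++ map (τ' τ Δ) (map inj₁ P))
    ≡⟨ sum-++ (map (τ' τ Δ) (tabulate gadget)) _ ⟩
  sum (map (τ' τ Δ) (tabulate gadget)) + sum (map (τ' τ Δ) (map inj₁ P))
    ≡⟨ cong₂ _+_ (cong sum (map-tabulate gadget (τ' τ Δ))) (cong sum (sym (map-∘ P))) ⟩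
  sumFin r (bundleτ Δ ∘ c) + len τ P
    ≡⟨ +-comm _ (len τ P) ⟩
  len τ P + sumFin r (bundleτ Δ ∘ c)
    ≡⟨ cong (len τ P +_) gadget-cost ⟩
  len τ P + countΔ c * Δ ∎
  where
  open ≡-Reasoning

  gadget : Fin r → X ⊎ (Fin r × Fin (suc k))
  gadget p = inj₂ (opposite p , c p)

  gadget-cost : sumFin r (bundleτ Δ ∘ c) ≡ countΔ c * Δ
  gadget-cost = trans (sumFin≡∑ r _)
    (trans (sum-cong-≗ (bundleτ≡δ*Δ Δ ∘ c)) (sym (*-distribʳ-sum Δ (λ p → δ (c p) zero))))

module _ {G : Digraph} {s t : V G} {d k r : ℕ} (τ : A G → ℕ) (Δ : ℕ) where

  convoy⇒minMax : suc k + r ≡ d → (R : ConvoyRouting G s t d (suc k)) →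
    Σ (Fin (suc k) → List (A G ⊎ (Fin r × Fin (suc k)))) λ Q →
      DisjointPaths (D' G s r (suc k)) (sPrime s r) (inj₁ t) (suc k) Q
      × minMaxObj (τ' τ Δ) (suc k) Q ≡ makespan τ Δ R
  convoy⇒minMax k+r≡d R = Q , (Q-paths , Q-disjoint) , maxFin-cong (suc k) Q-length
    where
    open ConvoyRouting R

    extra : Fin (suc k) → ℕ
    extra i = σ i ∸ 1

    suc-extra : ∀ i → suc (extra i) ≡ σ i
    suc-extra i with σ i | σ-pos i
    ... | suc _ | _ = refl

    ∑extra≡r : ∑ extra ≡ r
    ∑extra≡r = +-cancelˡ-≡ (suc k) _ _ (begin
      suc k + ∑ extra               ≡⟨ ∑-suc (suc k) extra ⟨
      ∑[ i < suc k ] suc (extra i)  ≡⟨ sum-cong-≗ suc-extra ⟩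
      ∑ σ                           ≡⟨ sumFin≡∑ (suc k) σ ⟨
      sumFin (suc k) σ              ≡⟨ trans σ-sum (sym k+r≡d) ⟩
      suc k + r                     ∎)
      where open ≡-Reasoning

    owner : Σ[ w ∈ (Fin r → Fin (suc k)) ] ∀ i → ∑[ p < r ] δ i (w p) ≡ extra i
    owner = subst (λ n → Σ[ w ∈ (Fin n → Fin (suc k)) ] ∀ i → ∑[ p < n ] δ i (w p) ≡ extra i)
                  ∑extra≡r (blockOwner extra , blockOwner-fibre extra)

    -- In bundle p the owner takes the Δ-arc zero; the transposition keeps the paths on distinct arcs.
    choice : Fin (suc k) → Fin r → Fin (suc k)
    choice i p = transpose (proj₁ owner p) zero i

    countΔ-choice : ∀ i → countΔ (choice i) ≡ extra i
    countΔ-choice i = trans (sum-cong-≗ owner-pays) (proj₂ owner i)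
      where
      owner-pays : ∀ p → δ (choice i p) zero ≡ δ i (proj₁ owner p)
      owner-pays p = trans (cong (δ (choice i p)) (sym (transpose-matchˡ (proj₁ owner p) zero)))
                           (δ-injective transpose-injective i (proj₁ owner p))

    Q : Fin (suc k) → List (A G ⊎ (Fin r × Fin (suc k)))
    Q i = route (choice i) (paths i)

    Q-paths : ∀ i → IsPath (D' G s r (suc k)) (sPrime s r) (inj₁ t) (Q i)
    Q-paths i = route-isPath (choice i) (proj₁ disjoint i)

    Q-disjoint : ∀ i i′ → i ≢ i′ → Disjoint (Q i) (Q i′)
    Q-disjoint i i′ i≢i′ = route-disjoint (proj₂ disjoint i i′ i≢i′) (λ p → i≢i′ ∘ transpose-injective)

    Q-length : ∀ i → len (τ' τ Δ) (Q i) ≡ len τ (paths i) + extra i * Δ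
    Q-length i = trans (len-route τ Δ (choice i) (paths i))
                       (cong (λ n → len τ (paths i) + n * Δ) (countΔ-choice i))

  minMax⇒convoy : suc k + r ≡ d → (Q : Fin (suc k) → List (A G ⊎ (Fin r × Fin (suc k)))) →
    DisjointPaths (D' G s r (suc k)) (sPrime s r) (inj₁ t) (suc k) Q →
    Σ (ConvoyRouting G s t d (suc k)) λ R → makespan τ Δ R ≡ minMaxObj (τ' τ Δ) (suc k) Q
  minMax⇒convoy k+r≡d Q (Q-paths , Q-disjoint) = R , maxFin-cong (suc k) (sym ∘ Q-length)
    where
    choice : Fin (suc k) → Fin r → Fin (suc k)
    choice i = proj₁ (path⇒route (Q-paths i))

    P : Fin (suc k) → List (A G)
    P i = proj₁ (proj₂ (path⇒route (Q-paths i)))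

    Q≡route : ∀ i → Q i ≡ route (choice i) (P i)
    Q≡route i = proj₁ (proj₂ (proj₂ (path⇒route (Q-paths i))))

    P-paths : ∀ i → IsPath G s t (P i)
    P-paths i = proj₂ (proj₂ (proj₂ (path⇒route (Q-paths i))))

    routes-disjoint : ∀ i i′ → i ≢ i′ → Disjoint (P i) (P i′) × (∀ p → choice i p ≢ choice i′ p)
    routes-disjoint i i′ i≢i′ =
      route-disjoint⁻ (subst₂ Disjoint (Q≡route i) (Q≡route i′) (Q-disjoint i i′ i≢i′))

    choice-injective : ∀ p → Injective _≡_ _≡_ (λ i → choice i p)
    choice-injective p {i} {i′} e with i ≟ i′
    ... | yes i≡i′ = i≡i′
    ... | no i≢i′  = contradiction e (proj₂ (routes-disjoint i i′ i≢i′) p)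

    -- In each bundle the k paths use the k arcs injectively, hence bijectively, so exactly one pays Δ.
    ∑countΔ≡r : ∑[ i < suc k ] countΔ (choice i) ≡ r
    ∑countΔ≡r = trans (∑-comm (λ i p → δ (choice i p) zero))
                      (trans (sum-cong-≗ (λ p → ∑-δ-injective (choice-injective p) zero)) (∑-1 r))

    R : ConvoyRouting G s t d (suc k)
    R = record
      { paths    = P
      ; disjoint = P-paths , (λ i i′ → proj₁ ∘ routes-disjoint i i′)
      ; σ        = suc ∘ countΔ ∘ choice
      ; σ-pos    = λ _ → s≤s z≤n
      ; σ-sum    = trans (sumFin≡∑ (suc k) (suc ∘ countΔ ∘ choice))
                     (trans (∑-suc (suc k) (countΔ ∘ choice)) (trans (cong (suc k +_) ∑countΔ≡r) k+r≡d))
      }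

    Q-length : ∀ i → len (τ' τ Δ) (Q i) ≡ len τ (P i) + countΔ (choice i) * Δ
    Q-length i = trans (cong (len (τ' τ Δ)) (Q≡route i)) (len-route τ Δ (choice i) (P i))

lemma25 : (n m : ℕ) (tl hd : Fin m → Fin n) (τ : Fin m → ℕ) (s t : Fin n) (d Δ : ℕ) →
          1 ≤ Δ → (k : ℕ) → 1 ≤ k → k ≤ m → k ≤ d →
          ((R : ConvoyRouting (graph n m tl hd) s t d k) →
             Σ (Fin k → List (Fin m ⊎ (Fin (d ∸ k) × Fin k))) (λ Q →
               DisjointPaths (D' (graph n m tl hd) s (d ∸ k) k) (sPrime s (d ∸ k)) (_⊎_.inj₁ t) k Q
               × minMaxObj (τ' τ Δ) k Q ≡ makespan τ Δ R))
          ×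
          ((Q : Fin k → List (Fin m ⊎ (Fin (d ∸ k) × Fin k))) →
             DisjointPaths (D' (graph n m tl hd) s (d ∸ k) k) (sPrime s (d ∸ k)) (_⊎_.inj₁ t) k Q →
             Σ (ConvoyRouting (graph n m tl hd) s t d k) (λ R →
               makespan τ Δ R ≡ minMaxObj (τ' τ Δ) k Q))
lemma25 n m tl hd τ s t d Δ _ (suc k) _ _ k≤d =
  convoy⇒minMax τ Δ (m+[n∸m]≡n k≤d) , minMax⇒convoy τ Δ (m+[n∸m]≡n k≤d)
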